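{- Let $m>0$ and $n\ge m$ be integers and let $p$ be a prime with $p\ge m$. Then $$\tau_{p,m}(n)=\begin{cases} m\lfloor\log_p n\rfloor & \text{if } a_p(n)\ge m,\\ m\lfloor\log_p n\rfloor + a_p(n)-m & \text{if } a_p(n)<m.\end{cases}$$
   Context: $\tau_{p,m}(n)=\max_{S\subset\{1,\ldots,n\},\,\#S=m} v_p\big(\prod_{k\in S}k\big)$ is the largest $p$-adic valuation of a product of $m$ distinct positive integers $\le n$. $\log_p$ is the base-$p$ logarithm, $\lfloor\cdot\rfloor$ the floor function, and $a_p(n)=\lfloor n\,p^{ -\lfloor\log_p n\rfloor}\rfloor$ is the leading nonzero digit of $n$ in base $p$. -}

module Defs where

open import Data.Nat using (ℕ; zero; suc; _+_; _*_; _∸_; _^_; _≤_; _<_; _/_; _<ᵇ_; NonZero)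
open import Data.Nat.Properties using (m^n≢0)
open import Data.Nat.Divisibility using (_∣_)
open import Data.Fin using (Fin; toℕ)
open import Data.Fin.Subset using (Subset; ∣_∣)
open import Data.Vec using ([]; _∷_)
open import Data.Bool using (true; false)
open import Data.Product using (_×_; Σ; _,_)
open import Relation.Binary.PropositionalEquality using (_≡_)
open import Relation.Nullary using (¬_)

IsVal : ℕ → ℕ → ℕ → Set
IsVal p x e = (p ^ e ∣ x) × ¬ (p ^ suc e ∣ x)

prodFrom : ∀ {k} → ℕ → Subset k → ℕ
prodFrom c [] = 1
prodFrom c (true ∷ T) = c * prodFrom (suc c) T
prodFrom c (false ∷ T) = prodFrom (suc c) T

-- ∏_{k ∈ S} k for S ⊆ {1,…,n}, where position i : Fin n encodes the integer toℕ i + 1.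
prodSub : ∀ {n} → Subset n → ℕ
prodSub S = prodFrom 1 S

IsTau : ℕ → ℕ → ℕ → ℕ → Set
IsTau p m n t =
  (Σ (Subset n) λ S → (∣ S ∣ ≡ m) × IsVal p (prodSub S) t) ×
  (∀ (S : Subset n) (e : ℕ) → ∣ S ∣ ≡ m → IsVal p (prodSub S) e → e ≤ t)

logAux : ℕ → ℕ → ℕ → ℕ
logAux zero q n = 0
logAux (suc f) q n with n <ᵇ suc (suc q)
... | true = 0
... | false = suc (logAux f q (n / suc (suc q)))

-- floorLog p n = ⌊log_p n⌋ for p ≥ 2, n ≥ 1 (fuel n suffices); junk 0 for p < 2.
floorLog : ℕ → ℕ → ℕ
floorLog (suc (suc q)) n = logAux n q n
floorLog _ n = 0

-- a_p(n) = ⌊ n · p^(-⌊log_p n⌋) ⌋ = n / p^⌊log_p n⌋ (p ≥ 2); junk for p < 2.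
leadDigit : ℕ → ℕ → ℕ
leadDigit (suc (suc q)) n =
  _/_ n (suc (suc q) ^ floorLog (suc (suc q)) n) {{m^n≢0 (suc (suc q)) (floorLog (suc (suc q)) n)}}
leadDigit _ n = n

module Submission where

-- Since v_p is additive, v_p(∏_{k∈S} k) = Σ_{k∈S} v_p(k).  Every k ≤ n < p·D has
-- v_p(k) ≤ L, with equality exactly when D ∣ k; hence v_p(k) + 1 ≤ L + [D ∣ k].
-- Exactly a integers in {1,…,n} are multiples of D.  Summing over an m-subset S
-- gives the two upper bounds  Σ_S v_p ≤ m·L  and  Σ_S v_p + m ≤ m·L + a.
-- They are attained: if m ≤ a by the multiples D, 2D, …, mD; if a < m (which
-- forces L ≥ 1) by the a multiples of D together with the multiples of p^(L−1)
-- up to (m − a)·p^(L−1) < D.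

open import Defs
open import Data.Nat using (ℕ; suc; _+_; _*_; _∸_; _≤_; _<_)
open import Data.Nat.Primality using (Prime)
open import Data.Product using (_×_)

open import Data.Nat
open import Data.Nat.Properties
open import Data.Nat.DivMod
open import Data.Nat.Divisibility
open import Data.Nat.Primality using (euclidsLemma; prime⇒nonTrivial)
open import Data.Nat.Solver using (module +-*-Solver)
open import Data.Bool using (Bool; true; false; T; _∧_; _∨_; if_then_else_)
open import Data.Bool.Properties using (∧-identityʳ; ∧-zeroʳ; T-∧)
open import Function.Bundles using (Equivalence)
open import Data.Product using (Σ; _,_; proj₁; proj₂)
open import Data.Sum using (inj₁; inj₂; [_,_]′)
open import Data.Unit using (tt)
open import Data.Empty using (⊥-elim)
open import Data.Fin.Subset using (Subset; ∣_∣)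
open import Data.Vec using ([]; _∷_)
open import Relation.Binary.PropositionalEquality
open import Relation.Nullary
open import Relation.Nullary.Decidable using (dec-true; dec-false)
open +-*-Solver

quotient-bounds : ∀ N d .{{_ : NonZero d}} → (N / d) * d ≤ N × N < suc (N / d) * d
quotient-bounds N d = m/n*n≤m N d , (begin-strict
    N                   ≡⟨ m≡m%n+[m/n]*n N d ⟩
    N % d + (N / d) * d <⟨ +-monoˡ-< ((N / d) * d) (m%n<n N d) ⟩
    suc (N / d) * d     ∎)
  where open ≤-Reasoning

quotient-unique : ∀ {N c d} .{{_ : NonZero d}} → c * d ≤ N → N < suc c * d → N / d ≡ c
quotient-unique {N} {c} {d} lo hi =
  ≤-antisym (≤-pred (m<n*o⇒m/o<n hi)) (subst (_≤ N / d) (m*n/n≡m c d) (/-monoˡ-≤ d lo))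

module FloorLog (q : ℕ) where

  b : ℕ
  b = suc (suc q)

  logAux-bounds : ∀ f n → 1 ≤ n → n ≤ f → b ^ logAux f q n ≤ n × n < b ^ suc (logAux f q n)
  logAux-bounds zero zero () _
  logAux-bounds zero (suc n) _ ()
  logAux-bounds (suc f) n 1≤n n≤f with n <ᵇ b in eq
  ... | true = 1≤n , subst (n <_) (sym (*-identityʳ b)) (<ᵇ⇒< n b (subst T (sym eq) tt))
  ... | false = lower , upper
    where
      instance _ = >-nonZero 1≤n
      b≤n : b ≤ n
      b≤n = ≮⇒≥ (λ n<b → subst T eq (<⇒<ᵇ n<b))
      n/b<n : n / b < n
      n/b<n = m/n<m n b (s≤s (s≤s z≤n))
      L = logAux f q (n / b)
      ih : b ^ L ≤ n / b × n / b < b ^ suc L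
      ih = logAux-bounds f (n / b) (m≥n⇒m/n>0 b≤n) (≤-pred (≤-trans n/b<n n≤f))
      lower : b * b ^ L ≤ n
      lower = ≤-trans (*-monoʳ-≤ b (proj₁ ih)) (subst (_≤ n) (*-comm (n / b) b) (m/n*n≤m n b))
      upper : n < b * b ^ suc L
      upper = <-≤-trans (proj₂ (quotient-bounds n b))
                (≤-trans (*-monoˡ-≤ b (proj₂ ih)) (≤-reflexive (*-comm (b ^ suc L) b)))

  floorLog-bounds : ∀ n → 1 ≤ n → b ^ floorLog b n ≤ n × n < b ^ suc (floorLog b n)
  floorLog-bounds n 1≤n = logAux-bounds n n 1≤n ≤-refl

^-∣ : ∀ b {i j} → i ≤ j → b ^ i ∣ b ^ j
^-∣ b {i} {j} i≤j = divides (b ^ (j ∸ i)) (begin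
    b ^ j             ≡⟨ cong (b ^_) (m+[n∸m]≡n i≤j) ⟨
    b ^ (i + (j ∸ i)) ≡⟨ ^-distribˡ-+-* b i (j ∸ i) ⟩
    b ^ i * b ^ (j ∸ i) ≡⟨ *-comm (b ^ i) _ ⟩
    b ^ (j ∸ i) * b ^ i ∎)
  where open ≡-Reasoning

val-max : ∀ {p x e e'} → IsVal p x e → p ^ e' ∣ x → e' ≤ e
val-max {p} {e = e} {e'} (_ , ¬p^1+e∣x) p^e'∣x with e' ≤? e
... | yes e'≤e = e'≤e
... | no e'≰e = ⊥-elim (¬p^1+e∣x (∣-trans (^-∣ p (≰⇒> e'≰e)) p^e'∣x))

val-≤ : ∀ {p x e L} → 0 < x → x < p ^ suc L → IsVal p x e → e ≤ L
val-≤ {p} {x} {e} {L} x>0 x<p^1+L (p^e∣x , _) with e ≤? L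
... | yes e≤L = e≤L
... | no e≰L = ⊥-elim (<-irrefl refl (≤-<-trans (∣⇒≤ {{>-nonZero x>0}} p^1+L∣x) x<p^1+L))
  where p^1+L∣x = ∣-trans (^-∣ p (≰⇒> e≰L)) p^e∣x

sumSub : ∀ {k} → (ℕ → ℕ) → ℕ → Subset k → ℕ
sumSub f c [] = 0
sumSub f c (true ∷ T) = f c + sumSub f (suc c) T
sumSub f c (false ∷ T) = sumSub f (suc c) T

full : ∀ k → Subset k
full zero = []
full (suc k) = true ∷ full k

select : (ℕ → Bool) → ℕ → ∀ k → Subset k
select b c zero = []
select b c (suc k) = b c ∷ select b (suc c) k

χ : Bool → ℕ
χ b = if b then 1 else 0

sumTo : (ℕ → ℕ) → ℕ → ℕ
sumTo f zero = 0
sumTo f (suc N) = sumTo f N + f (suc N)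

sumSub-const : ∀ {k} L c (T : Subset k) → sumSub (λ _ → L) c T ≡ ∣ T ∣ * L
sumSub-const L c [] = refl
sumSub-const L c (true ∷ T) = cong (L +_) (sumSub-const L (suc c) T)
sumSub-const L c (false ∷ T) = sumSub-const L (suc c) T

sumSub-+ : ∀ {k} f g c (T : Subset k) → sumSub (λ x → f x + g x) c T ≡ sumSub f c T + sumSub g c T
sumSub-+ f g c [] = refl
sumSub-+ f g c (true ∷ T) rewrite sumSub-+ f g (suc c) T =
  solve 4 (λ a b u v → (a :+ b) :+ (u :+ v) := (a :+ u) :+ (b :+ v)) refl
    (f c) (g c) (sumSub f (suc c) T) (sumSub g (suc c) T)
sumSub-+ f g c (false ∷ T) = sumSub-+ f g (suc c) T

range-tail : ∀ {P : ℕ → Set} c k → (∀ x → c ≤ x → x < c + suc k → P x) →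
             ∀ x → suc c ≤ x → x < suc c + k → P x
range-tail c k P x c<x x<1+c+k = P x (<⇒≤ c<x) (subst (x <_) (sym (+-suc c k)) x<1+c+k)

sumSub-mono : ∀ {k} f g c (T : Subset k) → (∀ x → c ≤ x → x < c + k → f x ≤ g x) →
              sumSub f c T ≤ sumSub g c T
sumSub-mono f g c [] f≤g = z≤n
sumSub-mono {suc k} f g c (true ∷ T) f≤g =
  +-mono-≤ (f≤g c ≤-refl (subst (c <_) (sym (+-suc c k)) (s≤s (m≤m+n c k))))
           (sumSub-mono f g (suc c) T (range-tail c k f≤g))
sumSub-mono {suc k} f g c (false ∷ T) f≤g = sumSub-mono f g (suc c) T (range-tail c k f≤g)

sumSub-≤-full : ∀ {k} f c (T : Subset k) → sumSub f c T ≤ sumSub f c (full k)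
sumSub-≤-full f c [] = z≤n
sumSub-≤-full f c (true ∷ T) = +-monoʳ-≤ (f c) (sumSub-≤-full f (suc c) T)
sumSub-≤-full f c (false ∷ T) = ≤-trans (sumSub-≤-full f (suc c) T) (m≤n+m _ (f c))

sumSub-mono-select : ∀ b f g c k → (∀ x → c ≤ x → T (b x) → f x ≤ g x) →
                     sumSub f c (select b c k) ≤ sumSub g c (select b c k)
sumSub-mono-select b f g c zero f≤g = z≤n
sumSub-mono-select b f g c (suc k) f≤g with b c in eq
... | true = +-mono-≤ (f≤g c ≤-refl (subst T (sym eq) tt)) (sumSub-mono-select b f g (suc c) k (λ x c<x → f≤g x (<⇒≤ c<x)))
... | false = sumSub-mono-select b f g (suc c) k (λ x c<x → f≤g x (<⇒≤ c<x))

sumSub-select : ∀ b f c k → sumSub f c (select b c k) ≡ sumSub (λ x → if b x then f x else 0) c (full k)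
sumSub-select b f c zero = refl
sumSub-select b f c (suc k) with b c
... | true = cong (f c +_) (sumSub-select b f (suc c) k)
... | false = sumSub-select b f (suc c) k

sumSub-full : ∀ f n → sumSub f 1 (full n) ≡ sumTo f n
sumSub-full f n = trans (sym (+-identityʳ _)) (shifted 0 n)
  where
    shifted : ∀ c k → sumSub f (suc c) (full k) + sumTo f c ≡ sumTo f (c + k)
    shifted c zero = cong (sumTo f) (sym (+-identityʳ c))
    shifted c (suc k) = begin
        (f (suc c) + sumSub f (suc (suc c)) (full k)) + sumTo f c
          ≡⟨ solve 3 (λ a s t → (a :+ s) :+ t := s :+ (t :+ a)) refl (f (suc c)) (sumSub f (suc (suc c)) (full k)) (sumTo f c) ⟩
        sumSub f (suc (suc c)) (full k) + sumTo f (suc c) ≡⟨ shifted (suc c) k ⟩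
        sumTo f (suc c + k)                               ≡⟨ cong (sumTo f) (+-suc c k) ⟨
        sumTo f (c + suc k)                               ∎
      where open ≡-Reasoning

∣select∣ : ∀ b n → ∣ select b 1 n ∣ ≡ sumTo (λ x → χ (b x)) n
∣select∣ b n = begin
    ∣ select b 1 n ∣                        ≡⟨ *-identityʳ _ ⟨
    ∣ select b 1 n ∣ * 1                    ≡⟨ sumSub-const 1 1 (select b 1 n) ⟨
    sumSub (λ _ → 1) 1 (select b 1 n)       ≡⟨ sumSub-select b (λ _ → 1) 1 n ⟩
    sumSub (λ x → χ (b x)) 1 (full n)       ≡⟨ sumSub-full (λ x → χ (b x)) n ⟩
    sumTo (λ x → χ (b x)) n                 ∎
  where open ≡-Reasoning

sumTo-ext : ∀ f g N → (∀ x → 1 ≤ x → x ≤ N → f x ≡ g x) → sumTo f N ≡ sumTo g N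
sumTo-ext f g zero f≡g = refl
sumTo-ext f g (suc N) f≡g =
  cong₂ _+_ (sumTo-ext f g N (λ x 1≤x x≤N → f≡g x 1≤x (m≤n⇒m≤1+n x≤N))) (f≡g (suc N) (s≤s z≤n) ≤-refl)

sumTo-+ : ∀ f g N → sumTo (λ x → f x + g x) N ≡ sumTo f N + sumTo g N
sumTo-+ f g zero = refl
sumTo-+ f g (suc N) rewrite sumTo-+ f g N =
  solve 4 (λ a b u v → (a :+ b) :+ (u :+ v) := (a :+ u) :+ (b :+ v)) refl
    (sumTo f N) (sumTo g N) (f (suc N)) (g (suc N))

sumTo-vanishing : ∀ f K N → (∀ x → K < x → f x ≡ 0) → K ≤ N → sumTo f N ≡ sumTo f K
sumTo-vanishing f K zero f≡0 z≤n = refl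
sumTo-vanishing f K (suc N) f≡0 K≤1+N with m≤n⇒m<n∨m≡n K≤1+N
... | inj₂ refl = refl
... | inj₁ K<1+N =
  trans (cong₂ _+_ (sumTo-vanishing f K N f≡0 (≤-pred K<1+N)) (f≡0 (suc N) K<1+N)) (+-identityʳ _)

prime⇒1<p : ∀ {p} → Prime p → 1 < p
prime⇒1<p {p} p-prime = nonTrivial⇒n>1 p {{prime⇒nonTrivial p-prime}}

module Valuation (p : ℕ) (p-prime : Prime p) where

  1<p : 1 < p
  1<p = prime⇒1<p p-prime

  instance
    p≢0 : NonZero p
    p≢0 = >-nonZero (<-trans z<s 1<p)

  val-one : IsVal p 1 0
  val-one = ∣-refl , λ p*1∣1 → <⇒≱ 1<p (subst (_≤ 1) (*-identityʳ p) (∣⇒≤ p*1∣1))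

  val-cofactor : ∀ {x e} → IsVal p x e → Σ ℕ λ x' → (x ≡ x' * p ^ e) × ¬ (p ∣ x')
  val-cofactor {x} {e} (divides x' x≡ , ¬p^1+e∣x) = x' , x≡ , λ { (divides r x'≡) → ¬p^1+e∣x (divides r (begin
      x               ≡⟨ x≡ ⟩
      x' * p ^ e      ≡⟨ cong (_* p ^ e) x'≡ ⟩
      (r * p) * p ^ e ≡⟨ *-assoc r p (p ^ e) ⟩
      r * (p * p ^ e) ∎)) }
    where open ≡-Reasoning

  -- Additivity; this is where primality is used (Euclid's lemma on the cofactors).
  val-* : ∀ {x y e f} → IsVal p x e → IsVal p y f → IsVal p (x * y) (e + f)
  val-* {x} {y} {e} {f} vx vy with val-cofactor {x} {e} vx | val-cofactor {y} {f} vy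
  ... | x' , x≡ , p∤x' | y' , y≡ , p∤y' = p^e+f∣xy , ¬p^1+e+f∣xy
    where
      P = p ^ e * p ^ f
      p^e+f≡P : p ^ (e + f) ≡ P
      p^e+f≡P = ^-distribˡ-+-* p e f
      instance _ = subst NonZero p^e+f≡P (m^n≢0 p (e + f))
      xy≡ : x * y ≡ (x' * y') * P
      xy≡ = begin
        x * y                         ≡⟨ cong₂ _*_ x≡ y≡ ⟩
        (x' * p ^ e) * (y' * p ^ f)   ≡⟨ solve 4 (λ a b c d → (a :* b) :* (c :* d) := (a :* c) :* (b :* d)) refl x' (p ^ e) y' (p ^ f) ⟩
        (x' * y') * P                 ∎
        where open ≡-Reasoning
      p^e+f∣xy : p ^ (e + f) ∣ x * y
      p^e+f∣xy = divides (x' * y') (trans xy≡ (cong ((x' * y') *_) (sym p^e+f≡P)))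
      ¬p^1+e+f∣xy : ¬ (p ^ suc (e + f) ∣ x * y)
      ¬p^1+e+f∣xy d = [ p∤x' , p∤y' ]′ (euclidsLemma x' y' p-prime (*-cancelˡ-∣ P Pp∣Px'y'))
        where
          Pp∣Px'y' : P * p ∣ P * (x' * y')
          Pp∣Px'y' = subst₂ _∣_ (trans (cong (p *_) p^e+f≡P) (*-comm p P)) (trans xy≡ (*-comm (x' * y') P)) d

  val-exists : ∀ x → 1 ≤ x → Σ ℕ λ e → IsVal p x e
  val-exists x 1≤x = search x x 1≤x ≤-refl
    where
      search : ∀ f x → 1 ≤ x → x ≤ f → Σ ℕ λ e → IsVal p x e
      search zero zero () _
      search zero (suc x) _ ()
      search (suc f) x 1≤x x≤1+f with p ∣? x
      ... | no p∤x = 0 , divides x (sym (*-identityʳ x)) , λ p*1∣x → p∤x (subst (_∣ x) (*-identityʳ p) p*1∣x)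
      ... | yes (divides y x≡yp) = suc e , p^1+e∣x , ¬p^2+e∣x
        where
          1≤y : 1 ≤ y
          1≤y = n≢0⇒n>0 (λ y≡0 → <-irrefl refl (≤-trans 1≤x (≤-reflexive (trans x≡yp (cong (_* p) y≡0)))))
          y<x : y < x
          y<x = subst (y <_) (sym x≡yp) (subst (_< y * p) (*-identityʳ y) (*-monoʳ-< y {{>-nonZero 1≤y}} 1<p))
          ih = search f y 1≤y (≤-pred (≤-trans y<x x≤1+f))
          e = proj₁ ih
          p^1+e∣x : p * p ^ e ∣ x
          p^1+e∣x = subst (p * p ^ e ∣_) (trans (*-comm p y) (sym x≡yp)) (*-monoʳ-∣ p (proj₁ (proj₂ ih)))
          ¬p^2+e∣x : ¬ (p * (p * p ^ e) ∣ x)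
          ¬p^2+e∣x d = proj₂ (proj₂ ih) (*-cancelˡ-∣ p (subst (p * (p * p ^ e) ∣_) (trans x≡yp (*-comm y p)) d))

  -- v x = v_p(x) for x ≥ 1 (and 0 at x = 0, a value never used).
  v : ℕ → ℕ
  v zero = 0
  v (suc k) = proj₁ (val-exists (suc k) (s≤s z≤n))

  v-spec : ∀ k → IsVal p (suc k) (v (suc k))
  v-spec k = proj₂ (val-exists (suc k) (s≤s z≤n))

  val-prodFrom : ∀ {k} c (T : Subset k) → IsVal p (prodFrom (suc c) T) (sumSub v (suc c) T)
  val-prodFrom c [] = val-one
  val-prodFrom c (true ∷ T) = val-* {e = v (suc c)} (v-spec c) (val-prodFrom (suc c) T)
  val-prodFrom c (false ∷ T) = val-prodFrom (suc c) T

  V : ∀ {n} → Subset n → ℕ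
  V S = sumSub v 1 S

  isTau-intro : ∀ {m n} t → (∀ (S : Subset n) → ∣ S ∣ ≡ m → V S ≤ t) →
                (S : Subset n) → ∣ S ∣ ≡ m → t ≤ V S → IsTau p m n t
  isTau-intro t upper S ∣S∣≡m t≤VS =
    (S , ∣S∣≡m , subst (IsVal p (prodSub S)) (≤-antisym (upper S ∣S∣≡m) t≤VS) (val-prodFrom 0 S)) ,
    λ S' e ∣S'∣≡m val → ≤-trans (val-max {e = V S'} (val-prodFrom 0 S') (proj₁ val)) (upper S' ∣S'∣≡m)

divides? : ℕ → ℕ → Bool
divides? d x = does (d ∣? x)

divides?-sound : ∀ {d x} → T (divides? d x) → d ∣ x
divides?-sound {d} {x} t with d ∣? x
... | yes d∣x = d∣x

module Multiples (d : ℕ) .{{_ : NonZero d}} where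

  count : ℕ → ℕ
  count = sumTo (λ x → χ (divides? d x))

  count-bounds : ∀ N → count N * d ≤ N × N < suc (count N) * d
  count-bounds zero = z≤n , subst (0 <_) (sym (+-identityʳ d)) (>-nonZero⁻¹ d)
  count-bounds (suc N) with d ∣? suc N | count-bounds N
  ... | yes (divides r 1+N≡rd) | lo , hi =
    subst (λ c → c * d ≤ suc N × suc N < suc c * d) (+-comm 1 (count N))
      (≤-reflexive (sym 1+N≡cd) , subst (_< d + suc (count N) * d) (sym 1+N≡cd) (m<n+m _ (>-nonZero⁻¹ d)))
    where
      -- r·d = N + 1 lies in (c·d, (c+1)·d], so r = c + 1.
      r≡1+c : r ≡ suc (count N)
      r≡1+c = ≤-antisym (*-cancelʳ-≤ r (suc (count N)) d (subst (_≤ suc (count N) * d) 1+N≡rd hi))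
                        (*-cancelʳ-< d (count N) r (≤-<-trans lo (subst (N <_) 1+N≡rd ≤-refl)))
      1+N≡cd : suc N ≡ suc (count N) * d
      1+N≡cd = trans 1+N≡rd (cong (_* d) r≡1+c)
  ... | no d∤1+N | lo , hi =
    subst (λ c → c * d ≤ suc N × suc N < suc c * d) (sym (+-identityʳ (count N)))
      (m≤n⇒m≤1+n lo , ≤∧≢⇒< hi (λ 1+N≡cd → d∤1+N (divides (suc (count N)) 1+N≡cd)))

  count≡quotient : ∀ N → count N ≡ N / d
  count≡quotient N = sym (quotient-unique (proj₁ (count-bounds N)) (proj₂ (count-bounds N)))

  upTo : ℕ → ℕ → Bool
  upTo K x = divides? d x ∧ (x ≤ᵇ K)

  upTo-∣ : ∀ {K x} → T (upTo K x) → d ∣ x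
  upTo-∣ t = divides?-sound (proj₁ (Equivalence.to T-∧ t))

  upTo-≤ : ∀ {K x} → T (upTo K x) → x ≤ K
  upTo-≤ {K} {x} t = ≤ᵇ⇒≤ x K (proj₂ (Equivalence.to (T-∧ {divides? d x}) t))

  count-upTo : ∀ K N → K ≤ N → sumTo (λ x → χ (upTo K x)) N ≡ K / d
  count-upTo K N K≤N = begin
      sumTo (λ x → χ (upTo K x)) N ≡⟨ sumTo-vanishing _ K N beyond K≤N ⟩
      sumTo (λ x → χ (upTo K x)) K ≡⟨ sumTo-ext _ _ K below ⟩
      count K                      ≡⟨ count≡quotient K ⟩
      K / d                        ∎
    where
      open ≡-Reasoning
      beyond : ∀ x → K < x → χ (upTo K x) ≡ 0
      beyond x K<x = cong χ (trans (cong (divides? d x ∧_) (dec-false (x ≤? K) (<⇒≱ K<x))) (∧-zeroʳ _))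
      below : ∀ x → 1 ≤ x → x ≤ K → χ (upTo K x) ≡ χ (divides? d x)
      below x _ x≤K = cong χ (trans (cong (divides? d x ∧_) (dec-true (x ≤? K) x≤K)) (∧-identityʳ _))

module Main (q : ℕ) (p-prime : Prime (suc (suc q))) (m n : ℕ) (0<m : 0 < m) (m≤n : m ≤ n)
            (m≤p : m ≤ suc (suc q)) where

  p : ℕ
  p = suc (suc q)

  open Valuation p p-prime

  L : ℕ
  L = floorLog p n

  D : ℕ
  D = p ^ L

  instance
    D≢0 : NonZero D
    D≢0 = m^n≢0 p L

  a : ℕ
  a = leadDigit p n

  D≤n : D ≤ n
  D≤n = proj₁ (FloorLog.floorLog-bounds q n (≤-trans 0<m m≤n))

  n<pD : n < p * D
  n<pD = proj₂ (FloorLog.floorLog-bounds q n (≤-trans 0<m m≤n))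

  aD≤n : a * D ≤ n
  aD≤n = proj₁ (quotient-bounds n D)

  n<[1+a]D : n < suc a * D
  n<[1+a]D = proj₂ (quotient-bounds n D)

  1≤a : 1 ≤ a
  1≤a = m≥n⇒m/n>0 D≤n

  count-D : Multiples.count D n ≡ a
  count-D = Multiples.count≡quotient D n

  v≤L : ∀ x → 1 ≤ x → x < 1 + n → v x ≤ L
  v≤L (suc k) _ x<1+n = val-≤ z<s (≤-<-trans (≤-pred x<1+n) n<pD) (v-spec k)

  v+1≤L+[D∣x] : ∀ x → 1 ≤ x → x < 1 + n → v x + 1 ≤ L + χ (divides? D x)
  v+1≤L+[D∣x] (suc k) 1≤x x<1+n with D ∣? suc k
  ... | yes _ = +-monoˡ-≤ 1 (v≤L (suc k) 1≤x x<1+n)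
  ... | no D∤x = subst₂ _≤_ (+-comm 1 (v (suc k))) (sym (+-identityʳ L))
                   (≰⇒> (λ L≤v → D∤x (∣-trans (^-∣ p L≤v) (proj₁ (v-spec k)))))

  sum-const : ∀ (S : Subset n) c → ∣ S ∣ ≡ m → sumSub (λ _ → c) 1 S ≡ m * c
  sum-const S c ∣S∣≡m = trans (sumSub-const c 1 S) (cong (_* c) ∣S∣≡m)

  bound-L : ∀ (S : Subset n) → ∣ S ∣ ≡ m → V S ≤ m * L
  bound-L S ∣S∣≡m = ≤-trans (sumSub-mono v (λ _ → L) 1 S v≤L) (≤-reflexive (sum-const S L ∣S∣≡m))

  bound-digit : ∀ (S : Subset n) → ∣ S ∣ ≡ m → V S + m ≤ m * L + a
  bound-digit S ∣S∣≡m = begin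
      V S + m                             ≡⟨ cong (V S +_) (trans (sum-const S 1 ∣S∣≡m) (*-identityʳ m)) ⟨
      V S + sumSub (λ _ → 1) 1 S          ≡⟨ sumSub-+ v (λ _ → 1) 1 S ⟨
      sumSub (λ x → v x + 1) 1 S          ≤⟨ sumSub-mono _ _ 1 S v+1≤L+[D∣x] ⟩
      sumSub (λ x → L + [D∣ x ]) 1 S      ≡⟨ sumSub-+ (λ _ → L) [D∣_] 1 S ⟩
      sumSub (λ _ → L) 1 S + sumSub [D∣_] 1 S
        ≤⟨ +-mono-≤ (≤-reflexive (sum-const S L ∣S∣≡m)) (sumSub-≤-full [D∣_] 1 S) ⟩
      m * L + sumSub [D∣_] 1 (full n)     ≡⟨ cong (m * L +_) (trans (sumSub-full [D∣_] n) count-D) ⟩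
      m * L + a                           ∎
    where
      open ≤-Reasoning
      [D∣_] : ℕ → ℕ
      [D∣ x ] = χ (divides? D x)

  case-large : m ≤ a → IsTau p m n (m * L)
  case-large m≤a = isTau-intro (m * L) bound-L S ∣S∣≡m lower
    where
      open Multiples D using (upTo; upTo-∣; count-upTo)
      S : Subset n
      S = select (upTo (m * D)) 1 n
      ∣S∣≡m : ∣ S ∣ ≡ m
      ∣S∣≡m = begin
        ∣ S ∣                               ≡⟨ ∣select∣ (upTo (m * D)) n ⟩
        sumTo (λ x → χ (upTo (m * D) x)) n  ≡⟨ count-upTo (m * D) n (≤-trans (*-monoˡ-≤ D m≤a) aD≤n) ⟩
        m * D / D                           ≡⟨ m*n/n≡m m D ⟩
        m                                   ∎
        where open ≡-Reasoning
      D∣x⇒L≤v : ∀ x → 1 ≤ x → T (upTo (m * D) x) → L ≤ v x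
      D∣x⇒L≤v (suc k) _ t = val-max (v-spec k) (upTo-∣ {m * D} t)
      lower : m * L ≤ V S
      lower = subst (_≤ V S) (sum-const S L ∣S∣≡m) (sumSub-mono-select _ (λ _ → L) v 1 n D∣x⇒L≤v)

  -- If a < m then L ≥ 1, for L = 0 would give a = n ≥ m.
  L≢0 : a < m → L ≢ 0
  L≢0 a<m L≡0 = <⇒≱ a<m (≤-trans m≤n (≤-pred n<1+a))
    where
      n<1+a : n < suc a
      n<1+a = subst (n <_) (trans (cong (λ l → suc a * p ^ l) L≡0) (*-identityʳ (suc a))) n<[1+a]D

  -- If a < m, write L = L' + 1 and D' = p^L'.  The a multiples of D together
  -- with the m − a multiples of D' up to K = (m − a)·D' < D attain m·L' + a.
  module Small (a<m : a < m) (L' : ℕ) (L≡1+L' : L ≡ suc L') where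

    D' : ℕ
    D' = p ^ L'

    instance
      D'≢0 : NonZero D'
      D'≢0 = m^n≢0 p L'

    open Multiples D' using (upTo; upTo-∣; upTo-≤; count-upTo)

    K : ℕ
    K = (m ∸ a) * D'

    -- K < D because m − a < m ≤ p.
    K<D : K < D
    K<D = subst (K <_) (sym (cong (p ^_) L≡1+L'))
            (*-monoˡ-< D' (<-≤-trans (∸-monoʳ-< {m} {a} {0} 1≤a (<⇒≤ a<m)) m≤p))

    member : ℕ → Bool
    member x = divides? D x ∨ upTo K x

    S : Subset n
    S = select member 1 n

    -- No positive x ≤ K < D is a multiple of D, so the two kinds of members are disjoint.
    χ-member : ∀ x → 1 ≤ x → x ≤ n → χ (member x) ≡ χ (divides? D x) + χ (upTo K x)
    χ-member x 1≤x _ with divides? D x in D∣x | upTo K x in x≤K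
    ... | true | true = ⊥-elim (<-irrefl refl (≤-<-trans D≤K K<D))
      where
        D≤K : D ≤ K
        D≤K = ≤-trans (∣⇒≤ {{>-nonZero 1≤x}} (divides?-sound (subst T (sym D∣x) tt)))
                    (upTo-≤ (subst T (sym x≤K) tt))
    ... | true | false = refl
    ... | false | _ = refl

    ∣S∣≡m : ∣ S ∣ ≡ m
    ∣S∣≡m = begin
      ∣ S ∣                                                ≡⟨ ∣select∣ member n ⟩
      sumTo (λ x → χ (member x)) n                         ≡⟨ sumTo-ext _ _ n χ-member ⟩
      sumTo (λ x → χ (divides? D x) + χ (upTo K x)) n      ≡⟨ sumTo-+ _ _ n ⟩
      Multiples.count D n + sumTo (λ x → χ (upTo K x)) n   ≡⟨ cong₂ _+_ count-D (count-upTo K n K≤n) ⟩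
      a + K / D'                                           ≡⟨ cong (a +_) (m*n/n≡m (m ∸ a) D') ⟩
      a + (m ∸ a)                                          ≡⟨ m+[n∸m]≡n (<⇒≤ a<m) ⟩
      m                                                    ∎
      where
        open ≡-Reasoning
        K≤n = ≤-trans (<⇒≤ K<D) D≤n

    member⇒v≥ : ∀ x → 1 ≤ x → T (member x) → L' + χ (divides? D x) ≤ v x
    member⇒v≥ (suc k) _ t with D ∣? suc k
    ... | yes D∣x = val-max (v-spec k) (subst (λ l → p ^ l ∣ suc k) (trans L≡1+L' (+-comm 1 L')) D∣x)
    ... | no _ = subst (_≤ v (suc k)) (sym (+-identityʳ L')) (val-max (v-spec k) (upTo-∣ {K} t))

    members-[D∣] : sumSub (λ x → χ (divides? D x)) 1 S ≡ a
    members-[D∣] = begin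
      sumSub (λ x → χ (divides? D x)) 1 S                                ≡⟨ sumSub-select member _ 1 n ⟩
      sumSub (λ x → if member x then χ (divides? D x) else 0) 1 (full n) ≡⟨ sumSub-full _ n ⟩
      sumTo (λ x → if member x then χ (divides? D x) else 0) n           ≡⟨ sumTo-ext _ _ n masked ⟩
      Multiples.count D n                                                ≡⟨ count-D ⟩
      a                                                                  ∎
      where
        open ≡-Reasoning
        masked : ∀ x → 1 ≤ x → x ≤ n → (if member x then χ (divides? D x) else 0) ≡ χ (divides? D x)
        masked x _ _ with divides? D x | upTo K x
        ... | true | _ = refl
        ... | false | true = refl
        ... | false | false = refl

    lower : m * L' + a ≤ V S
    lower = begin
      m * L' + a                                                      ≡⟨ cong₂ _+_ (sum-const S L' ∣S∣≡m) members-[D∣] ⟨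
      sumSub (λ _ → L') 1 S + sumSub (λ x → χ (divides? D x)) 1 S     ≡⟨ sumSub-+ _ _ 1 S ⟨
      sumSub (λ x → L' + χ (divides? D x)) 1 S                        ≤⟨ sumSub-mono-select member _ v 1 n member⇒v≥ ⟩
      V S                                                             ∎
      where open ≤-Reasoning

    mL+a≡ : m * L + a ≡ m + (m * L' + a)
    mL+a≡ = begin
      m * L + a          ≡⟨ cong (λ l → m * l + a) L≡1+L' ⟩
      m * suc L' + a     ≡⟨ cong (_+ a) (*-suc m L') ⟩
      m + m * L' + a     ≡⟨ +-assoc m (m * L') a ⟩
      m + (m * L' + a)   ∎
      where open ≡-Reasoning

    target : m * L + a ∸ m ≡ m * L' + a
    target = trans (cong (_∸ m) mL+a≡) (m+n∸m≡n m (m * L' + a))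

    upper : ∀ (S : Subset n) → ∣ S ∣ ≡ m → V S ≤ m * L + a ∸ m
    upper S ∣S∣≡m = subst (V S ≤_) (sym target)
      (+-cancelˡ-≤ m _ _ (subst₂ _≤_ (+-comm (V S) m) mL+a≡ (bound-digit S ∣S∣≡m)))

    tau : IsTau p m n (m * L + a ∸ m)
    tau = isTau-intro _ upper S ∣S∣≡m (subst (_≤ V S) (sym target) lower)

  case-small : a < m → IsTau p m n (m * L + a ∸ m)
  case-small a<m = Small.tau a<m (pred L) (sym (suc-pred L {{≢-nonZero (L≢0 a<m)}}))

proposition4p1 : ∀ (p m n : ℕ) → 0 < m → m ≤ n → Prime p → m ≤ p →
    (m ≤ leadDigit p n → IsTau p m n (m * floorLog p n)) ×
    (leadDigit p n < m → IsTau p m n (m * floorLog p n + leadDigit p n ∸ m))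
proposition4p1 0 m n _ _ p-prime _ with prime⇒1<p p-prime
... | ()
proposition4p1 1 m n _ _ p-prime _ with prime⇒1<p p-prime
... | s≤s ()
proposition4p1 (suc (suc q)) m n 0<m m≤n p-prime m≤p = case-large , case-small
  where open Main q p-prime m n 0<m m≤n m≤p
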